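{- Let $A, B, C$ be integers such that $A, B, C, ABC$ are distinct square-free non-zero integers, and let $L_B = \mathbb{Q}(\sqrt{A}, \sqrt{B}, \sqrt{C})$ be the corresponding triquadratic number field. Suppose there exist non-zero rational numbers $a, b$ with $$a^2 - 1 = (B - A)\, b^2,$$ and suppose $B \neq a$. Then $\min\deg_{L_B}(\sqrt{A} + a\sqrt{B}) = 2$.
   Context: A primitive element of a number field $L$ of degree $n$ is an $\alpha \in L$ with $\mathbb{Q}(\alpha) = L$. For such $\alpha$, every $v \in L$ can be written uniquely as $v = f(\alpha)$ with $f \in \mathbb{Q}[x]$, $\deg f \leq n-1$; $\deg_\alpha(v) := \deg f$, and $\min\deg_L(v) := \min_\alpha \deg_\alpha(v)$ over all primitive elements $\alpha$ of $L$. -}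

module Defs where

open import Data.Bool using (Bool; true; false; _∧_; _xor_)
open import Data.Product using (_×_; _,_; Σ; ∃-syntax)
open import Data.Nat as ℕ using (ℕ; _≤_)
open import Data.Nat.Divisibility using (_∣_)
open import Data.Integer as ℤ using (ℤ; ∣_∣; +_)
open import Data.Rational as ℚ using (ℚ; 0ℚ; 1ℚ; _/_)
open import Data.Vec using (Vec; []; _∷_; last)
open import Relation.Binary.PropositionalEquality using (_≡_)
open import Relation.Nullary using (¬_)

SquareFree : ℤ → Set
SquareFree z = ∀ (p : ℕ) → (p ℕ.* p) ∣ ∣ z ∣ → p ≡ 1

ι : ℤ → ℚ
ι z = z / 1

-- The triquadratic field L = ℚ(√A, √B, √C), realised concretely as the
-- 8-dimensional ℚ-algebra with basis  e(i,j,k) = √A^i √B^j √C^k,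
-- i,j,k ∈ {0,1}, and multiplication e_s e_u = A^{s₁∧u₁} B^{s₂∧u₂} C^{s₃∧u₃} e_{s⊕u}.
-- (When [L:ℚ] = 8 this is exactly L = ℚ[x,y,z]/(x²-A, y²-B, z²-C).)

Idx : Set
Idx = Bool × Bool × Bool

idxs : Vec Idx 8
idxs = (false , false , false) ∷ (false , false , true) ∷ (false , true , false) ∷ (false , true , true)
     ∷ (true , false , false) ∷ (true , false , true) ∷ (true , true , false) ∷ (true , true , true) ∷ []

_⊕_ : Idx → Idx → Idx
(a , b , c) ⊕ (a' , b' , c') = (a xor a' , b xor b' , c xor c')

module Triquadratic (A B C : ℤ) where

  L : Set
  L = Idx → ℚ

  _≈_ : L → L → Set
  x ≈ y = ∀ t → x t ≡ y t

  private
    pick : Bool → ℚ → ℚ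
    pick true q = q
    pick false _ = 1ℚ

    coef : Idx → Idx → ℚ
    coef (a , b , c) (a' , b' , c') =
      pick (a ∧ a') (ι A) ℚ.* (pick (b ∧ b') (ι B) ℚ.* pick (c ∧ c') (ι C))

    sumV : ∀ {n} → Vec ℚ n → ℚ
    sumV [] = 0ℚ
    sumV (q ∷ qs) = q ℚ.+ sumV qs

    mapV : ∀ {n} → (Idx → ℚ) → Vec Idx n → Vec ℚ n
    mapV f [] = []
    mapV f (s ∷ ss) = f s ∷ mapV f ss

  e : Idx → L
  e s t with s ⊕ t
  ... | (false , false , false) = 1ℚ
  ... | _ = 0ℚ

  scalar : ℚ → L
  scalar q = λ t → q ℚ.* e (false , false , false) t

  _+L_ : L → L → L
  (x +L y) t = x t ℚ.+ y t

  _·L_ : ℚ → L → L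
  (q ·L x) t = q ℚ.* x t

  _*L_ : L → L → L
  (x *L y) t = sumV (mapV (λ s → x s ℚ.* (y (s ⊕ t) ℚ.* coef s (s ⊕ t))) idxs)

  √A √B : L
  √A = e (true , false , false)
  √B = e (false , true , false)

  -- evaluation f(α) of a polynomial given by its coefficient vector
  -- (constant term first), by Horner's rule
  evalPoly : ∀ {n} → Vec ℚ n → L → L
  evalPoly [] α = scalar 0ℚ
  evalPoly (c ∷ cs) α = scalar c +L (α *L evalPoly cs α)

  -- α is a primitive element: ℚ(α) = ℚ[α] = L, i.e. every v ∈ L is f(α)
  -- for some f ∈ ℚ[x] of degree ≤ 7 = [L:ℚ] - 1.
  Primitive : L → Set
  Primitive α = ∀ (v : L) → ∃[ f ] (evalPoly {8} f α ≈ v)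

  -- deg_α(v) = d : v = f(α) with f of degree exactly d ≤ 7
  -- (f has d+1 coefficients, leading coefficient non-zero).
  DegAlpha : L → L → ℕ → Set
  DegAlpha α v d = (d ≤ 7) × ∃[ f ] (¬ (last {n = d} f ≡ 0ℚ) × (evalPoly {ℕ.suc d} f α ≈ v))

  MinDeg : L → ℕ → Set
  MinDeg v m = (∃[ α ] (Primitive α × DegAlpha α v m))
             × (∀ α d → Primitive α → DegAlpha α v d → m ≤ d)

-- Put K = ℚ(√A, √B) and κ = a + ab√A + b√B - b²√A√B ∈ K. The relation a² - 1 = (B - A)b²
-- gives C κ² = c₀ + N (√A + a√B) with N = 2Cb(a² - Bb²) ≠ 0, so √A + a√B is a quadratic
-- polynomial in β = √C κ. And β is primitive: a polynomial in β is P(Cκ²) + β Q(Cκ²), where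
-- Cκ² is an affine image of v = √A + a√B, whose powers 1, v, v², v³ span K as a ≠ 0 and A ≠ a²B,
-- and κ is invertible because A, B are square-free, distinct and ≠ 1. Conversely √A + a√B is not
-- rational, and if it were c + dα with d ≠ 0 then α would lie in K, which does not contain √C.

module Submission where

open import Defs
open import Level using (0ℓ)
open import Algebra.Bundles.Raw using (RawRing)
open import Data.Bool.Base using (Bool; true; false; _∧_)
open import Data.Empty using (⊥; ⊥-elim)
open import Data.List.Base using (List; []; _∷_)
open import Data.Maybe.Base using (Maybe; just; nothing)
open import Data.Nat.Base as ℕ using (ℕ; z≤n; s≤s)
import Data.Nat.Properties as ℕ
open import Data.Nat.Divisibility using (_∣_; divides; ∣-refl)
import Data.Nat.Coprimality as Coprimality
open import Data.Integer as ℤ using (ℤ; +_; -[1+_]; ∣_∣)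
import Data.Integer.Properties as ℤ
open import Data.Product.Base using (_×_; _,_; proj₁; proj₂)
open import Data.Rational as ℚ using (ℚ; mkℚ; 0ℚ; 1ℚ)
open import Data.Rational.Literals using (fromℤ)
import Data.Rational.Properties as ℚ
open import Data.Rational.Unnormalised as ℚᵘ using (*≡*)
import Data.Rational.Unnormalised.Properties as ℚᵘ
open import Data.Sum.Base using (_⊎_; inj₁; inj₂; [_,_]′; reduce)
open import Data.Vec.Base as Vec using (Vec; []; _∷_; _++_; take; drop; tabulate; toList; foldr′)
open import Relation.Binary.PropositionalEquality
open import Relation.Nullary using (¬_; Dec; yes; no)
open import Algebra.Properties.Group ℚ.+-0-group using (x∙y⁻¹≈ε⇒x≈y; inverseˡ-unique)
import Tactic.RingSolver.Core.AlmostCommutativeRing as ACR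
open import Tactic.RingSolver using (solve-∀)

zero? : (p : ℚ) → Maybe (0ℚ ≡ p)
zero? p with 0ℚ ℚ.≟ p
... | yes 0≡p = just 0≡p
... | no _    = nothing

ℚ-ring : ACR.AlmostCommutativeRing 0ℓ 0ℓ
ℚ-ring = ACR.fromCommutativeRing ℚ.+-*-commutativeRing zero?

open import Tactic.RingSolver.NonReflective ℚ-ring using (Expr; Κ; Ι; ⊝_; module Ops)
  renaming (_⊕_ to _⊕ₑ_; _⊗_ to _⊗ₑ_)

Expr-rawRing : ℕ → RawRing 0ℓ 0ℓ
Expr-rawRing n = record
  { Carrier = Expr ℚ n ; _≈_ = _≡_ ; _+_ = _⊕ₑ_ ; _*_ = _⊗ₑ_ ; -_ = ⊝_ ; 0# = Κ 0ℚ ; 1# = Κ 1ℚ }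

-- Formulas are written once over an arbitrary raw ring: at ℚ they are the objects of the proof,
-- at the solver's expressions they let byRing check identities between them by normalisation.

record Biquadratic (R : Set) : Set where
  constructor ⟨_,_,_,_⟩
  field c₁ c√A c√B c√AB : R
open Biquadratic public

⟨⟩-cong : ∀ {R : Set} {x₀ x₁ x₂ x₃ y₀ y₁ y₂ y₃ : R} →
          x₀ ≡ y₀ → x₁ ≡ y₁ → x₂ ≡ y₂ → x₃ ≡ y₃ → ⟨ x₀ , x₁ , x₂ , x₃ ⟩ ≡ ⟨ y₀ , y₁ , y₂ , y₃ ⟩
⟨⟩-cong refl refl refl refl = refl

module BiquadraticFormulas (R : RawRing 0ℓ 0ℓ) (A B : RawRing.Carrier R) where
  open RawRing R

  K : Set
  K = Biquadratic Carrier

  two three : Carrier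
  two   = 1# + 1#
  three = 1# + two

  0ᴷ 1ᴷ : K
  0ᴷ = ⟨ 0# , 0# , 0# , 0# ⟩
  1ᴷ = ⟨ 1# , 0# , 0# , 0# ⟩

  infixl 6 _+ᴷ_
  infixl 7 _*ᴷ_
  infixr 8 _⋆_

  _+ᴷ_ : K → K → K
  ⟨ x₀ , x₁ , x₂ , x₃ ⟩ +ᴷ ⟨ y₀ , y₁ , y₂ , y₃ ⟩ = ⟨ x₀ + y₀ , x₁ + y₁ , x₂ + y₂ , x₃ + y₃ ⟩

  _⋆_ : Carrier → K → K
  q ⋆ ⟨ x₀ , x₁ , x₂ , x₃ ⟩ = ⟨ q * x₀ , q * x₁ , q * x₂ , q * x₃ ⟩

  _*ᴷ_ : K → K → K
  ⟨ x₀ , x₁ , x₂ , x₃ ⟩ *ᴷ ⟨ y₀ , y₁ , y₂ , y₃ ⟩ =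
    ⟨ x₀ * y₀ + (A * (x₁ * y₁) + (B * (x₂ * y₂) + A * B * (x₃ * y₃)))
    , x₀ * y₁ + (x₁ * y₀ + B * (x₂ * y₃ + x₃ * y₂))
    , x₀ * y₂ + (x₂ * y₀ + A * (x₁ * y₃ + x₃ * y₁))
    , x₀ * y₃ + (x₃ * y₀ + (x₁ * y₂ + x₂ * y₁)) ⟩

  conj√A conj√B : K → K
  conj√A ⟨ x₀ , x₁ , x₂ , x₃ ⟩ = ⟨ x₀ , - x₁ , x₂ , - x₃ ⟩
  conj√B ⟨ x₀ , x₁ , x₂ , x₃ ⟩ = ⟨ x₀ , x₁ , - x₂ , - x₃ ⟩

  -- x · conj√B x lies in ℚ(√A); its ℚ(√A)-norm is the norm of x.
  norm : K → Carrier
  norm x = c₁ y * c₁ y + - (A * (c√A y * c√A y))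
    where
    y : K
    y = x *ᴷ conj√B x

  adjugate : K → K
  adjugate x = conj√B x *ᴷ conj√A (x *ᴷ conj√B x)

  horner : List Carrier → K → K
  horner []       x = 0ᴷ
  horner (p ∷ ps) x = p ⋆ 1ᴷ +ᴷ x *ᴷ horner ps x

  -- the coefficients of p (c + n X) for a cubic p
  shift : Carrier → Carrier → Vec Carrier 4 → Vec Carrier 4
  shift c n (p₀ ∷ p₁ ∷ p₂ ∷ p₃ ∷ []) =
      p₀ + c * (p₁ + c * (p₂ + c * p₃))
    ∷ n * (p₁ + c * (two * p₂ + three * (c * p₃)))
    ∷ n * n * (p₂ + three * (c * p₃))
    ∷ n * n * n * p₃
    ∷ []

module TriquadraticFormulas (R : RawRing 0ℓ 0ℓ) (A B C : RawRing.Carrier R) where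
  open RawRing R
  open BiquadraticFormulas R A B public

  lo hi : (Idx → Carrier) → K
  lo x = ⟨ x (false , false , false) , x (true , false , false) , x (false , true , false) , x (true , true , false) ⟩
  hi x = ⟨ x (false , false , true) , x (true , false , true) , x (false , true , true) , x (true , true , true) ⟩

  infixr 5 _⊹_

  _⊹_ : K → K → Idx → Carrier
  (x ⊹ y) (i , j , false) = coordinate x i j
    where
    coordinate : K → Bool → Bool → Carrier
    coordinate x false false = c₁ x
    coordinate x true  false = c√A x
    coordinate x false true  = c√B x
    coordinate x true  true  = c√AB x
  (x ⊹ y) (i , j , true)  = (y ⊹ x) (i , j , false)

  -- _*L_ of Defs, restated over R
  _*ᴸ_ : (Idx → Carrier) → (Idx → Carrier) → Idx → Carrier
  (x *ᴸ y) t = foldr′ _+_ 0# (Vec.map (λ s → x s * (y (s ⊕ t) * coef s (s ⊕ t))) idxs)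
    where
    pick : Bool → Carrier → Carrier
    pick true  q = q
    pick false _ = 1#
    coef : Idx → Idx → Carrier
    coef (i , j , k) (i′ , j′ , k′) = pick (i ∧ i′) A * (pick (j ∧ j′) B * pick (k ∧ k′) C)

module SumOfRootsFormulas (R : RawRing 0ℓ 0ℓ) (A B a : RawRing.Carrier R) where
  open RawRing R
  open BiquadraticFormulas R A B public

  v : K
  v = ⟨ 0# , 1# , a , 0# ⟩

  D : Carrier
  D = A + - (a * a * B)

  -- coordinates in the basis 1, v, v², v³, given ½, a⁻¹ and (2D)⁻¹
  vCoordinates : Carrier → Carrier → Carrier → K → Vec Carrier 4
  vCoordinates half a⁻¹ d⁻¹ ⟨ z₀ , z₁ , z₂ , z₃ ⟩ = q₀ ∷ q₁ ∷ q₂ ∷ q₃ ∷ []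
    where
    q₀ q₁ q₂ q₃ : Carrier
    q₂ = half * (a⁻¹ * z₃)
    q₃ = d⁻¹ * (a⁻¹ * z₂ + - z₁)
    q₁ = z₁ + - (q₃ * (A + three * (a * a * B)))
    q₀ = z₀ + - (q₂ * (A + a * a * B))

module WitnessFormulas (R : RawRing 0ℓ 0ℓ) (A B C a b : RawRing.Carrier R) where
  open RawRing R
  open SumOfRootsFormulas R A B a public

  κ : K
  κ = ⟨ a , a * b , b , - (b * b) ⟩

  m m′ N c₀ : Carrier
  m  = a * a + - (B * (b * b))
  m′ = 1# + - (A * (b * b))
  N  = two * (C * (b * m))
  c₀ = C * ((a * a + B * (b * b)) * (1# + A * (b * b)))

module Eᴷ {n} = BiquadraticFormulas (Expr-rawRing n)
module Eᴸ {n} = TriquadraticFormulas (Expr-rawRing n)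
module Eⱽ {n} = SumOfRootsFormulas (Expr-rawRing n)
module Eᵂ {n} = WitnessFormulas (Expr-rawRing n)

coordinates : ∀ {R : Set} {m} → Vec (Biquadratic R) m → Vec R (m ℕ.* 4)
coordinates []                       = []
coordinates (⟨ x , y , z , w ⟩ ∷ xs) = x ∷ y ∷ z ∷ w ∷ coordinates xs

biquadratics : ∀ {R : Set} m → Vec R (m ℕ.* 4) → Vec (Biquadratic R) m
biquadratics ℕ.zero    []                   = []
biquadratics (ℕ.suc m) (x ∷ y ∷ z ∷ w ∷ xs) = ⟨ x , y , z , w ⟩ ∷ biquadratics m xs

map₄ : ∀ {R S : Set} → (R → S) → Biquadratic R → Biquadratic S
map₄ f ⟨ x , y , z , w ⟩ = ⟨ f x , f y , f z , f w ⟩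

-- f receives s scalar and m biquadratic variables; the hypothesis (proved by refl)
-- says that the two sides have the same normal form.
byRing : ∀ s m (f : Vec (Expr ℚ (s ℕ.+ m ℕ.* 4)) s → Vec (Biquadratic (Expr ℚ (s ℕ.+ m ℕ.* 4))) m →
                    Biquadratic (Expr ℚ (s ℕ.+ m ℕ.* 4)) × Biquadratic (Expr ℚ (s ℕ.+ m ℕ.* 4)))
         (xs : Vec ℚ s) (ys : Vec (Biquadratic ℚ) m) →
         let ρ       = xs ++ coordinates ys
             vars    = tabulate Ι
             (l , r) = f (take s vars) (biquadratics m (drop s vars))
         in map₄ (λ e → Ops.⟦ e ⇓⟧ ρ) l ≡ map₄ (λ e → Ops.⟦ e ⇓⟧ ρ) r →
            map₄ (λ e → Ops.⟦ e ⟧ ρ) l ≡ map₄ (λ e → Ops.⟦ e ⟧ ρ) r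
byRing s m f xs ys nf =
  ⟨⟩-cong (coordinate c₁ (cong c₁ nf)) (coordinate c√A (cong c√A nf))
          (coordinate c√B (cong c√B nf)) (coordinate c√AB (cong c√AB nf))
  where
  n : ℕ
  n = s ℕ.+ m ℕ.* 4
  ρ : Vec ℚ n
  ρ = xs ++ coordinates ys
  l r : Biquadratic (Expr ℚ n)
  l = proj₁ (f (take s (tabulate Ι)) (biquadratics m (drop s (tabulate Ι))))
  r = proj₂ (f (take s (tabulate Ι)) (biquadratics m (drop s (tabulate Ι))))
  coordinate : (π : Biquadratic (Expr ℚ n) → Expr ℚ n) →
               Ops.⟦ π l ⇓⟧ ρ ≡ Ops.⟦ π r ⇓⟧ ρ → Ops.⟦ π l ⟧ ρ ≡ Ops.⟦ π r ⟧ ρ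
  coordinate π = Ops.prove ρ (π l) (π r)

p*q≡0⇒p≡0∨q≡0 : ∀ p q → p ℚ.* q ≡ 0ℚ → p ≡ 0ℚ ⊎ q ≡ 0ℚ
p*q≡0⇒p≡0∨q≡0 p q pq≡0 with p ℚ.≟ 0ℚ
... | yes p≡0 = inj₁ p≡0
... | no  p≢0 = inj₂ (begin
  q                     ≡⟨ ℚ.*-identityˡ q ⟨
  1ℚ ℚ.* q              ≡⟨ cong (ℚ._* q) (ℚ.*-inverseˡ p) ⟨
  ℚ.1/ p ℚ.* p ℚ.* q    ≡⟨ ℚ.*-assoc (ℚ.1/ p) p q ⟩
  ℚ.1/ p ℚ.* (p ℚ.* q)  ≡⟨ cong (ℚ.1/ p ℚ.*_) pq≡0 ⟩
  ℚ.1/ p ℚ.* 0ℚ         ≡⟨ ℚ.*-zeroʳ (ℚ.1/ p) ⟩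
  0ℚ                    ∎)
  where
  instance _ = ℚ.≢-nonZero p≢0
  open ≡-Reasoning

p≢0∧q≢0⇒p*q≢0 : ∀ {p q} → p ≢ 0ℚ → q ≢ 0ℚ → p ℚ.* q ≢ 0ℚ
p≢0∧q≢0⇒p*q≢0 {p} {q} p≢0 q≢0 pq≡0 with p*q≡0⇒p≡0∨q≡0 p q pq≡0
... | inj₁ p≡0 = p≢0 p≡0
... | inj₂ q≡0 = q≢0 q≡0

p≢0∧p*q≡0⇒q≡0 : ∀ {p q} → p ≢ 0ℚ → p ℚ.* q ≡ 0ℚ → q ≡ 0ℚ
p≢0∧p*q≡0⇒q≡0 {p} {q} p≢0 pq≡0 with p*q≡0⇒p≡0∨q≡0 p q pq≡0
... | inj₁ p≡0 = ⊥-elim (p≢0 p≡0)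
... | inj₂ q≡0 = q≡0

ι≡fromℤ : ∀ z → ι z ≡ fromℤ z
ι≡fromℤ z = ℚ.↥p/↧p≡p (fromℤ z)

ι-injective : ∀ {y z} → ι y ≡ ι z → y ≡ z
ι-injective {y} {z} ιy≡ιz = cong ℚ.↥_ (trans (sym (ι≡fromℤ y)) (trans ιy≡ιz (ι≡fromℤ z)))

ι-neg : ∀ z → ι (ℤ.- z) ≡ ℚ.- ι z
ι-neg z = trans (ι≡fromℤ (ℤ.- z)) (trans (fromℤ-neg z) (cong ℚ.-_ (sym (ι≡fromℤ z))))
  where
  fromℤ-neg : ∀ z → fromℤ (ℤ.- z) ≡ ℚ.- fromℤ z
  fromℤ-neg (+ 0)       = refl
  fromℤ-neg (+ ℕ.suc _) = refl
  fromℤ-neg -[1+ _ ]    = refl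

SquareFree-neg : ∀ {z} → SquareFree z → SquareFree (ℤ.- z)
SquareFree-neg {z} sf p p²∣∣-z∣ = sf p (subst (p ℕ.* p ∣_) (ℤ.∣-i∣≡∣i∣ z) p²∣∣-z∣)

-- Writing q = n/d in lowest terms, z d² = n² forces d = 1, and then n² ∣ z forces n = ±1.
SquareFree-square≡1 : ∀ {z} q → SquareFree z → ι z ≡ q ℚ.* q → z ≡ ℤ.1ℤ
SquareFree-square≡1 {z} q@(mkℚ n d-1 n⊥d) sf ιz≡q² = z≡1 n d-1≡0 ∣n∣≡1 z*d²≡n²
  where
  d : ℕ
  d = ℕ.suc d-1
  z*d²≡n² : z ℤ.* + (d ℕ.* d) ≡ n ℤ.* n ℤ.* + 1
  z*d²≡n² with ℚᵘ.≃-trans (ℚ.toℚᵘ-cong (trans (sym (ι≡fromℤ z)) ιz≡q²)) (ℚ.toℚᵘ-homo-* q q)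
  ... | *≡* eq = eq
  ∣z∣d²≡∣n∣² : ∣ z ∣ ℕ.* (d ℕ.* d) ≡ ∣ n ∣ ℕ.* ∣ n ∣
  ∣z∣d²≡∣n∣² = begin
    ∣ z ∣ ℕ.* (d ℕ.* d)    ≡⟨ ℤ.abs-* z (+ (d ℕ.* d)) ⟨
    ∣ z ℤ.* + (d ℕ.* d) ∣  ≡⟨ cong ∣_∣ z*d²≡n² ⟩
    ∣ n ℤ.* n ℤ.* + 1 ∣    ≡⟨ cong ∣_∣ (ℤ.*-identityʳ (n ℤ.* n)) ⟩
    ∣ n ℤ.* n ∣            ≡⟨ ℤ.abs-* n n ⟩
    ∣ n ∣ ℕ.* ∣ n ∣        ∎
    where open ≡-Reasoning
  d∣n : d ∣ ∣ n ∣
  d∣n = Coprimality.coprime-divisor (Coprimality.sym (Coprimality.recompute n⊥d))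
          (divides (∣ z ∣ ℕ.* d) (trans (sym ∣z∣d²≡∣n∣²) (sym (ℕ.*-assoc ∣ z ∣ d d))))
  d-1≡0 : d-1 ≡ 0
  d-1≡0 = ℕ.suc-injective (Coprimality.recompute n⊥d (d∣n , ∣-refl))
  ∣z∣≡∣n∣² : ∣ z ∣ ≡ ∣ n ∣ ℕ.* ∣ n ∣
  ∣z∣≡∣n∣² = trans (sym (ℕ.*-identityʳ ∣ z ∣))
                   (subst (λ k → ∣ z ∣ ℕ.* (ℕ.suc k ℕ.* ℕ.suc k) ≡ _) d-1≡0 ∣z∣d²≡∣n∣²)
  ∣n∣≡1 : ∣ n ∣ ≡ 1
  ∣n∣≡1 = sf ∣ n ∣ (divides 1 (trans ∣z∣≡∣n∣² (sym (ℕ.*-identityˡ _))))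
  z≡1 : ∀ n {d-1} → d-1 ≡ 0 → ∣ n ∣ ≡ 1 → z ℤ.* + (ℕ.suc d-1 ℕ.* ℕ.suc d-1) ≡ n ℤ.* n ℤ.* + 1 → z ≡ ℤ.1ℤ
  z≡1 (+ 1)    refl refl eq = trans (sym (ℤ.*-identityʳ z)) eq
  z≡1 -[1+ 0 ] refl refl eq = trans (sym (ℤ.*-identityʳ z)) eq

SquareFree-scaledSquare≡1 : ∀ {z} x y → SquareFree z → y ≢ 0ℚ → ι z ℚ.* (y ℚ.* y) ≡ x ℚ.* x → z ≡ ℤ.1ℤ
SquareFree-scaledSquare≡1 {z} x y sf y≢0 eq = SquareFree-square≡1 (x ℚ.* ℚ.1/ y) sf (begin
  ι z                                          ≡⟨ ℚ.*-identityʳ (ι z) ⟨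
  ι z ℚ.* (1ℚ ℚ.* 1ℚ)                          ≡⟨ cong (λ p → ι z ℚ.* (p ℚ.* p)) (ℚ.*-inverseʳ y) ⟨
  ι z ℚ.* ((y ℚ.* ℚ.1/ y) ℚ.* (y ℚ.* ℚ.1/ y))  ≡⟨ regroup (ι z) y (ℚ.1/ y) ⟩
  ι z ℚ.* (y ℚ.* y) ℚ.* (ℚ.1/ y ℚ.* ℚ.1/ y)    ≡⟨ cong (ℚ._* (ℚ.1/ y ℚ.* ℚ.1/ y)) eq ⟩
  x ℚ.* x ℚ.* (ℚ.1/ y ℚ.* ℚ.1/ y)              ≡⟨ regroup′ x (ℚ.1/ y) ⟩
  x ℚ.* ℚ.1/ y ℚ.* (x ℚ.* ℚ.1/ y)              ∎)
  where
  instance _ = ℚ.≢-nonZero y≢0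
  open ≡-Reasoning
  regroup : ∀ p y w → p ℚ.* ((y ℚ.* w) ℚ.* (y ℚ.* w)) ≡ p ℚ.* (y ℚ.* y) ℚ.* (w ℚ.* w)
  regroup = solve-∀ ℚ-ring
  regroup′ : ∀ x w → x ℚ.* x ℚ.* (w ℚ.* w) ≡ x ℚ.* w ℚ.* (x ℚ.* w)
  regroup′ = solve-∀ ℚ-ring

SquareFree-scaledSquare≡-1 : ∀ {z} x y → SquareFree z → y ≢ 0ℚ → x ℚ.* x ℚ.+ ι z ℚ.* (y ℚ.* y) ≡ 0ℚ → z ≡ ℤ.-1ℤ
SquareFree-scaledSquare≡-1 {z} x y sf y≢0 eq = begin
  z          ≡⟨ ℤ.neg-involutive z ⟨
  ℤ.- ℤ.- z  ≡⟨ cong ℤ.-_ (SquareFree-scaledSquare≡1 x y (SquareFree-neg {z} sf) y≢0 ι[-z]y²≡x²) ⟩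
  ℤ.-1ℤ      ∎
  where
  open ≡-Reasoning
  ι[-z]y²≡x² : ι (ℤ.- z) ℚ.* (y ℚ.* y) ≡ x ℚ.* x
  ι[-z]y²≡x² = begin
    ι (ℤ.- z) ℚ.* (y ℚ.* y)    ≡⟨ cong (ℚ._* (y ℚ.* y)) (ι-neg z) ⟩
    ℚ.- ι z ℚ.* (y ℚ.* y)      ≡⟨ ℚ.neg-distribˡ-* (ι z) (y ℚ.* y) ⟨
    ℚ.- (ι z ℚ.* (y ℚ.* y))    ≡⟨ inverseˡ-unique (x ℚ.* x) (ι z ℚ.* (y ℚ.* y)) eq ⟨
    x ℚ.* x                    ∎

module BiquadraticIdentities (A B : ℚ) where
  open BiquadraticFormulas ℚ.+-*-rawRing A B public

  ⋆-identityˡ : ∀ x → 1ℚ ⋆ x ≡ x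
  ⋆-identityˡ x = ⟨⟩-cong (ℚ.*-identityˡ _) (ℚ.*-identityˡ _) (ℚ.*-identityˡ _) (ℚ.*-identityˡ _)

  ⋆-cancel : ∀ {d x} → d ≢ 0ℚ → d ⋆ x ≡ 0ᴷ → x ≡ 0ᴷ
  ⋆-cancel d≢0 dx≡0 = ⟨⟩-cong (p≢0∧p*q≡0⇒q≡0 d≢0 (cong c₁ dx≡0)) (p≢0∧p*q≡0⇒q≡0 d≢0 (cong c√A dx≡0))
                              (p≢0∧p*q≡0⇒q≡0 d≢0 (cong c√B dx≡0)) (p≢0∧p*q≡0⇒q≡0 d≢0 (cong c√AB dx≡0))

  horner-linear : ∀ p q x → horner (p ∷ q ∷ []) x ≡ p ⋆ 1ᴷ +ᴷ q ⋆ x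
  horner-linear p q x = byRing 4 1
    (λ { (A ∷ B ∷ p ∷ q ∷ []) (x ∷ []) → let module E = Eᴷ A B in
         E.horner (p ∷ q ∷ []) x , p E.⋆ E.1ᴷ E.+ᴷ q E.⋆ x })
    (A ∷ B ∷ p ∷ q ∷ []) (x ∷ []) refl

  horner-shift : ∀ c n (p : Vec ℚ 4) x → horner (toList (shift c n p)) x ≡ horner (toList p) (c ⋆ 1ᴷ +ᴷ n ⋆ x)
  horner-shift c n (p₀ ∷ p₁ ∷ p₂ ∷ p₃ ∷ []) x = byRing 8 1
    (λ { (A ∷ B ∷ c ∷ n ∷ p₀ ∷ p₁ ∷ p₂ ∷ p₃ ∷ []) (x ∷ []) → let module E = Eᴷ A B in
         E.horner (toList (E.shift c n (p₀ ∷ p₁ ∷ p₂ ∷ p₃ ∷ []))) x ,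
         E.horner (p₀ ∷ p₁ ∷ p₂ ∷ p₃ ∷ []) (c E.⋆ E.1ᴷ E.+ᴷ n E.⋆ x) })
    (A ∷ B ∷ c ∷ n ∷ p₀ ∷ p₁ ∷ p₂ ∷ p₃ ∷ []) (x ∷ []) refl

  affine-inverse : ∀ u c n x → (ℚ.- (u ℚ.* c)) ⋆ 1ᴷ +ᴷ u ⋆ (c ⋆ 1ᴷ +ᴷ n ⋆ x) ≡ (u ℚ.* n) ⋆ x
  affine-inverse u c n x = byRing 5 1
    (λ { (A ∷ B ∷ u ∷ c ∷ n ∷ []) (x ∷ []) → let module E = Eᴷ A B in
         (⊝ (u ⊗ₑ c)) E.⋆ E.1ᴷ E.+ᴷ u E.⋆ (c E.⋆ E.1ᴷ E.+ᴷ n E.⋆ x) , (u ⊗ₑ n) E.⋆ x })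
    (A ∷ B ∷ u ∷ c ∷ n ∷ []) (x ∷ []) refl

  *-adjugate : ∀ r x z → x *ᴷ r ⋆ (adjugate x *ᴷ z) ≡ (r ℚ.* norm x) ⋆ z
  *-adjugate r x z = byRing 3 2
    (λ { (A ∷ B ∷ r ∷ []) (x ∷ z ∷ []) → let module E = Eᴷ A B in
         x E.*ᴷ r E.⋆ (E.adjugate x E.*ᴷ z) , (r ⊗ₑ E.norm x) E.⋆ z })
    (A ∷ B ∷ r ∷ []) (x ∷ z ∷ []) refl

evens odds : ∀ {A : Set} {n} → Vec A n → List A
evens []       = []
evens (x ∷ xs) = x ∷ odds xs
odds  []       = []
odds  (x ∷ xs) = evens xs

interleave : ∀ {A : Set} {n} → Vec A n → Vec A n → Vec A (n ℕ.* 2)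
interleave []       []       = []
interleave (x ∷ xs) (y ∷ ys) = x ∷ y ∷ interleave xs ys

evens-interleave : ∀ {A : Set} {n} (xs ys : Vec A n) → evens (interleave xs ys) ≡ toList xs
evens-interleave []       []       = refl
evens-interleave (x ∷ xs) (y ∷ ys) = cong (x ∷_) (evens-interleave xs ys)

odds-interleave : ∀ {A : Set} {n} (xs ys : Vec A n) → odds (interleave xs ys) ≡ toList ys
odds-interleave []       []       = refl
odds-interleave (x ∷ xs) (y ∷ ys) = cong (y ∷_) (odds-interleave xs ys)

-- L = K(√C) as pairs over K = ℚ(√A, √B)

module TriquadraticField (A B C : ℤ) where
  open Triquadratic A B C
  open BiquadraticIdentities (ι A) (ι B) public
  open TriquadraticFormulas ℚ.+-*-rawRing (ι A) (ι B) (ι C) public using (lo; hi; _⊹_)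

  lo-* : ∀ x y → lo (x *L y) ≡ lo x *ᴷ lo y +ᴷ ι C ⋆ (hi x *ᴷ hi y)
  lo-* x y = byRing 3 4
    (λ { (A ∷ B ∷ C ∷ []) (x₀ ∷ x₁ ∷ y₀ ∷ y₁ ∷ []) → let module E = Eᴸ A B C in
         E.lo ((x₀ E.⊹ x₁) E.*ᴸ (y₀ E.⊹ y₁)) , x₀ E.*ᴷ y₀ E.+ᴷ C E.⋆ (x₁ E.*ᴷ y₁) })
    (ι A ∷ ι B ∷ ι C ∷ []) (lo x ∷ hi x ∷ lo y ∷ hi y ∷ []) refl

  hi-* : ∀ x y → hi (x *L y) ≡ lo x *ᴷ hi y +ᴷ hi x *ᴷ lo y
  hi-* x y = byRing 3 4
    (λ { (A ∷ B ∷ C ∷ []) (x₀ ∷ x₁ ∷ y₀ ∷ y₁ ∷ []) → let module E = Eᴸ A B C in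
         E.hi ((x₀ E.⊹ x₁) E.*ᴸ (y₀ E.⊹ y₁)) , x₀ E.*ᴷ y₁ E.+ᴷ x₁ E.*ᴷ y₀ })
    (ι A ∷ ι B ∷ ι C ∷ []) (lo x ∷ hi x ∷ lo y ∷ hi y ∷ []) refl

  lo-cong : ∀ {x y} → x ≈ y → lo x ≡ lo y
  lo-cong x≈y = ⟨⟩-cong (x≈y _) (x≈y _) (x≈y _) (x≈y _)

  hi-cong : ∀ {x y} → x ≈ y → hi x ≡ hi y
  hi-cong x≈y = ⟨⟩-cong (x≈y _) (x≈y _) (x≈y _) (x≈y _)

  ≈-from-lo-hi : ∀ x y → lo x ≡ lo y → hi x ≡ hi y → x ≈ y
  ≈-from-lo-hi _ _ lo≡ hi≡ (false , false , false) = cong c₁ lo≡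
  ≈-from-lo-hi _ _ lo≡ hi≡ (true  , false , false) = cong c√A lo≡
  ≈-from-lo-hi _ _ lo≡ hi≡ (false , true  , false) = cong c√B lo≡
  ≈-from-lo-hi _ _ lo≡ hi≡ (true  , true  , false) = cong c√AB lo≡
  ≈-from-lo-hi _ _ lo≡ hi≡ (false , false , true)  = cong c₁ hi≡
  ≈-from-lo-hi _ _ lo≡ hi≡ (true  , false , true)  = cong c√A hi≡
  ≈-from-lo-hi _ _ lo≡ hi≡ (false , true  , true)  = cong c√B hi≡
  ≈-from-lo-hi _ _ lo≡ hi≡ (true  , true  , true)  = cong c√AB hi≡

  lo-√A+a√B : ∀ a → lo (√A +L (a ·L √B)) ≡ ⟨ 0ℚ , 1ℚ , a , 0ℚ ⟩
  lo-√A+a√B a = byRing 3 0 (λ { (A ∷ B ∷ a ∷ []) [] →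
    ⟨ Κ 0ℚ ⊕ₑ a ⊗ₑ Κ 0ℚ , Κ 1ℚ ⊕ₑ a ⊗ₑ Κ 0ℚ , Κ 0ℚ ⊕ₑ a ⊗ₑ Κ 1ℚ , Κ 0ℚ ⊕ₑ a ⊗ₑ Κ 0ℚ ⟩ ,
    ⟨ Κ 0ℚ , Κ 1ℚ , a , Κ 0ℚ ⟩ }) (ι A ∷ ι B ∷ a ∷ []) [] refl

  hi-√A+a√B : ∀ a → hi (√A +L (a ·L √B)) ≡ 0ᴷ
  hi-√A+a√B a = byRing 3 0 (λ { (A ∷ B ∷ a ∷ []) [] →
    ⟨ Κ 0ℚ ⊕ₑ a ⊗ₑ Κ 0ℚ , Κ 0ℚ ⊕ₑ a ⊗ₑ Κ 0ℚ , Κ 0ℚ ⊕ₑ a ⊗ₑ Κ 0ℚ , Κ 0ℚ ⊕ₑ a ⊗ₑ Κ 0ℚ ⟩ ,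
    ⟨ Κ 0ℚ , Κ 0ℚ , Κ 0ℚ , Κ 0ℚ ⟩ }) (ι A ∷ ι B ∷ a ∷ []) [] refl

  evalPoly-√C· : ∀ k {n} (f : Vec ℚ n) →
    lo (evalPoly f (0ᴷ ⊹ k)) ≡ horner (evens f) (ι C ⋆ (k *ᴷ k)) ×
    hi (evalPoly f (0ᴷ ⊹ k)) ≡ k *ᴷ horner (odds f) (ι C ⋆ (k *ᴷ k))
  evalPoly-√C· k []      = refl , byRing 2 1
    (λ { (A ∷ B ∷ []) (k ∷ []) → let module E = Eᴷ A B in Κ 0ℚ E.⋆ E.0ᴷ , k E.*ᴷ E.0ᴷ })
    (ι A ∷ ι B ∷ []) (k ∷ []) refl
  evalPoly-√C· k (c ∷ f) = lo-step , hi-step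
    where
    open ≡-Reasoning
    β y : L
    β = 0ᴷ ⊹ k
    y = evalPoly f β
    P Q : K
    P = horner (evens f) (ι C ⋆ (k *ᴷ k))
    Q = horner (odds f) (ι C ⋆ (k *ᴷ k))
    lo-step = begin
      c ⋆ 1ᴷ +ᴷ lo (β *L y)                          ≡⟨ cong (c ⋆ 1ᴷ +ᴷ_) (lo-* β y) ⟩
      c ⋆ 1ᴷ +ᴷ (0ᴷ *ᴷ lo y +ᴷ ι C ⋆ (k *ᴷ hi y))    ≡⟨ cong₂ (λ p q → c ⋆ 1ᴷ +ᴷ (0ᴷ *ᴷ p +ᴷ ι C ⋆ (k *ᴷ q)))
                                                              (proj₁ (evalPoly-√C· k f)) (proj₂ (evalPoly-√C· k f)) ⟩
      c ⋆ 1ᴷ +ᴷ (0ᴷ *ᴷ P +ᴷ ι C ⋆ (k *ᴷ (k *ᴷ Q)))   ≡⟨ byRing 4 3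
        (λ { (A ∷ B ∷ C ∷ c ∷ []) (k ∷ P ∷ Q ∷ []) → let module E = Eᴸ A B C in
             c E.⋆ E.1ᴷ E.+ᴷ (E.0ᴷ E.*ᴷ P E.+ᴷ C E.⋆ (k E.*ᴷ (k E.*ᴷ Q))) ,
             c E.⋆ E.1ᴷ E.+ᴷ C E.⋆ (k E.*ᴷ k) E.*ᴷ Q })
        (ι A ∷ ι B ∷ ι C ∷ c ∷ []) (k ∷ P ∷ Q ∷ []) refl ⟩
      c ⋆ 1ᴷ +ᴷ ι C ⋆ (k *ᴷ k) *ᴷ Q                  ∎
    hi-step = begin
      c ⋆ 0ᴷ +ᴷ hi (β *L y)                     ≡⟨ cong (c ⋆ 0ᴷ +ᴷ_) (hi-* β y) ⟩
      c ⋆ 0ᴷ +ᴷ (0ᴷ *ᴷ hi y +ᴷ k *ᴷ lo y)       ≡⟨ cong₂ (λ p q → c ⋆ 0ᴷ +ᴷ (0ᴷ *ᴷ q +ᴷ k *ᴷ p))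
                                                         (proj₁ (evalPoly-√C· k f)) (proj₂ (evalPoly-√C· k f)) ⟩
      c ⋆ 0ᴷ +ᴷ (0ᴷ *ᴷ (k *ᴷ Q) +ᴷ k *ᴷ P)      ≡⟨ byRing 3 3
        (λ { (A ∷ B ∷ c ∷ []) (k ∷ P ∷ Q ∷ []) → let module E = Eᴷ A B in
             c E.⋆ E.0ᴷ E.+ᴷ (E.0ᴷ E.*ᴷ (k E.*ᴷ Q) E.+ᴷ k E.*ᴷ P) , k E.*ᴷ P })
        (ι A ∷ ι B ∷ c ∷ []) (k ∷ P ∷ Q ∷ []) refl ⟩
      k *ᴷ P                                    ∎

  hi-evalPoly : ∀ α → hi α ≡ 0ᴷ → ∀ {n} (f : Vec ℚ n) → hi (evalPoly f α) ≡ 0ᴷ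
  hi-evalPoly α hiα≡0 []      = refl
  hi-evalPoly α hiα≡0 (c ∷ f) = begin
    c ⋆ 0ᴷ +ᴷ hi (α *L y)                 ≡⟨ cong (c ⋆ 0ᴷ +ᴷ_) (hi-* α y) ⟩
    c ⋆ 0ᴷ +ᴷ (lo α *ᴷ hi y +ᴷ hi α *ᴷ lo y) ≡⟨ cong₂ (λ p q → c ⋆ 0ᴷ +ᴷ (lo α *ᴷ p +ᴷ q *ᴷ lo y))
                                                     (hi-evalPoly α hiα≡0 f) hiα≡0 ⟩
    c ⋆ 0ᴷ +ᴷ (lo α *ᴷ 0ᴷ +ᴷ 0ᴷ *ᴷ lo y)  ≡⟨ byRing 3 2
      (λ { (A ∷ B ∷ c ∷ []) (x ∷ y ∷ []) → let module E = Eᴷ A B in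
           c E.⋆ E.0ᴷ E.+ᴷ (x E.*ᴷ E.0ᴷ E.+ᴷ E.0ᴷ E.*ᴷ y) , E.0ᴷ })
      (ι A ∷ ι B ∷ c ∷ []) (lo α ∷ lo y ∷ []) refl ⟩
    0ᴷ                                    ∎
    where
    open ≡-Reasoning
    y : L
    y = evalPoly f α

  hi≡0⇒¬primitive : ∀ α → hi α ≡ 0ᴷ → ¬ Primitive α
  hi≡0⇒¬primitive α hiα≡0 α-primitive = ℚ.1≢0 (sym (cong c₁ (begin
    0ᴷ                     ≡⟨ hi-evalPoly α hiα≡0 f ⟨
    hi (evalPoly f α)      ≡⟨ hi-cong f[α]≈√C ⟩
    hi (e (false , false , true)) ∎)))
    where
    open ≡-Reasoning
    f : Vec ℚ 8
    f = proj₁ (α-primitive (e (false , false , true)))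
    f[α]≈√C : evalPoly f α ≈ e (false , false , true)
    f[α]≈√C = proj₂ (α-primitive (e (false , false , true)))

  lo-evalPoly-constant : ∀ α c → lo (evalPoly (c ∷ []) α) ≡ c ⋆ 1ᴷ
  lo-evalPoly-constant α c = begin
    c ⋆ 1ᴷ +ᴷ lo (α *L scalar 0ℚ)                                   ≡⟨ cong (c ⋆ 1ᴷ +ᴷ_) (lo-* α (scalar 0ℚ)) ⟩
    c ⋆ 1ᴷ +ᴷ (lo α *ᴷ 0ℚ ⋆ 1ᴷ +ᴷ ι C ⋆ (hi α *ᴷ 0ℚ ⋆ 0ᴷ))         ≡⟨ byRing 4 2
      (λ { (A ∷ B ∷ C ∷ c ∷ []) (x ∷ y ∷ []) → let module E = Eᴸ A B C in
           c E.⋆ E.1ᴷ E.+ᴷ (x E.*ᴷ Κ 0ℚ E.⋆ E.1ᴷ E.+ᴷ C E.⋆ (y E.*ᴷ Κ 0ℚ E.⋆ E.0ᴷ)) , c E.⋆ E.1ᴷ })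
      (ι A ∷ ι B ∷ ι C ∷ c ∷ []) (lo α ∷ hi α ∷ []) refl ⟩
    c ⋆ 1ᴷ                                                          ∎
    where open ≡-Reasoning

  hi-evalPoly-linear : ∀ α c d → hi (evalPoly (c ∷ d ∷ []) α) ≡ d ⋆ hi α
  hi-evalPoly-linear α c d = begin
    c ⋆ 0ᴷ +ᴷ hi (α *L y)                                      ≡⟨ cong (c ⋆ 0ᴷ +ᴷ_) (hi-* α y) ⟩
    c ⋆ 0ᴷ +ᴷ (lo α *ᴷ hi y +ᴷ hi α *ᴷ lo y)                   ≡⟨ cong₂ (λ p q → c ⋆ 0ᴷ +ᴷ (lo α *ᴷ (d ⋆ 0ᴷ +ᴷ p) +ᴷ hi α *ᴷ q))
                                                                       (hi-* α (scalar 0ℚ)) (lo-evalPoly-constant α d) ⟩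
    c ⋆ 0ᴷ +ᴷ (lo α *ᴷ (d ⋆ 0ᴷ +ᴷ (lo α *ᴷ 0ℚ ⋆ 0ᴷ +ᴷ hi α *ᴷ 0ℚ ⋆ 1ᴷ)) +ᴷ hi α *ᴷ d ⋆ 1ᴷ) ≡⟨ byRing 4 2
      (λ { (A ∷ B ∷ c ∷ d ∷ []) (x ∷ y ∷ []) → let module E = Eᴷ A B in
           c E.⋆ E.0ᴷ E.+ᴷ (x E.*ᴷ (d E.⋆ E.0ᴷ E.+ᴷ (x E.*ᴷ Κ 0ℚ E.⋆ E.0ᴷ E.+ᴷ y E.*ᴷ Κ 0ℚ E.⋆ E.1ᴷ)) E.+ᴷ y E.*ᴷ d E.⋆ E.1ᴷ) ,
           d E.⋆ y })
      (ι A ∷ ι B ∷ c ∷ d ∷ []) (lo α ∷ hi α ∷ []) refl ⟩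
    d ⋆ hi α                                                   ∎
    where
    open ≡-Reasoning
    y : L
    y = evalPoly (d ∷ []) α

-- The upper bound

½ : ℚ
½ = + 1 ℚ./ 2

module UpperBound (A B C : ℤ) (a b : ℚ)
  (sfA : SquareFree A) (sfB : SquareFree B) (A≢B : A ≢ B) (A≢1 : A ≢ ℤ.1ℤ) (B≢1 : B ≢ ℤ.1ℤ)
  (a≢0 : a ≢ 0ℚ) (b≢0 : b ≢ 0ℚ) (C≢0 : C ≢ ℤ.0ℤ)
  (pell : a ℚ.* a ℚ.- 1ℚ ≡ (ι B ℚ.- ι A) ℚ.* (b ℚ.* b)) where

  open Triquadratic A B C
  open TriquadraticField A B C
  open WitnessFormulas ℚ.+-*-rawRing (ι A) (ι B) (ι C) a b using (v; D; vCoordinates; κ; m; m′; N; c₀)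

  pell-difference≡0 : a ℚ.* a ℚ.- 1ℚ ℚ.- (ι B ℚ.- ι A) ℚ.* (b ℚ.* b) ≡ 0ℚ
  pell-difference≡0 = trans (cong (ℚ._- (ι B ℚ.- ι A) ℚ.* (b ℚ.* b)) pell) (ℚ.+-inverseʳ ((ι B ℚ.- ι A) ℚ.* (b ℚ.* b)))

  m≡m′ : m ≡ m′
  m≡m′ = x∙y⁻¹≈ε⇒x≈y m m′ (trans (difference a b (ι A) (ι B)) pell-difference≡0)
    where
    difference : ∀ a b A B → a ℚ.* a ℚ.+ ℚ.- (B ℚ.* (b ℚ.* b)) ℚ.+ ℚ.- (1ℚ ℚ.+ ℚ.- (A ℚ.* (b ℚ.* b))) ≡
                             a ℚ.* a ℚ.- 1ℚ ℚ.- (B ℚ.- A) ℚ.* (b ℚ.* b)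
    difference = solve-∀ ℚ-ring

  m≢0 : m ≢ 0ℚ
  m≢0 m≡0 = B≢1 (SquareFree-scaledSquare≡1 a b sfB b≢0 (sym (x∙y⁻¹≈ε⇒x≈y (a ℚ.* a) (ι B ℚ.* (b ℚ.* b)) m≡0)))

  -- If A = a²B, the Pell relation factors as (a² - 1)(1 + Bb²) = 0.
  D≢0 : D ≢ 0ℚ
  D≢0 D≡0 = A≢B ([ a²-1≡0⇒A≡B , 1+Bb²≡0⇒A≡B ]′ (p*q≡0⇒p≡0∨q≡0 _ _ product≡0))
    where
    open ≡-Reasoning
    A≡a²B : ι A ≡ a ℚ.* a ℚ.* ι B
    A≡a²B = x∙y⁻¹≈ε⇒x≈y (ι A) (a ℚ.* a ℚ.* ι B) D≡0
    product≡0 : (a ℚ.* a ℚ.- 1ℚ) ℚ.* (1ℚ ℚ.+ ι B ℚ.* (b ℚ.* b)) ≡ 0ℚ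
    product≡0 = begin
      (a ℚ.* a ℚ.- 1ℚ) ℚ.* (1ℚ ℚ.+ ι B ℚ.* (b ℚ.* b))       ≡⟨ factor a b (ι A) (ι B) ⟩
      a ℚ.* a ℚ.- 1ℚ ℚ.- (ι B ℚ.- ι A) ℚ.* (b ℚ.* b) ℚ.- b ℚ.* b ℚ.* D ≡⟨ cong₂ (λ p q → p ℚ.- b ℚ.* b ℚ.* q) pell-difference≡0 D≡0 ⟩
      0ℚ ℚ.- b ℚ.* b ℚ.* 0ℚ                                 ≡⟨ vanish b ⟩
      0ℚ                                                    ∎
      where
      factor : ∀ a b A B → (a ℚ.* a ℚ.- 1ℚ) ℚ.* (1ℚ ℚ.+ B ℚ.* (b ℚ.* b)) ≡
                           a ℚ.* a ℚ.- 1ℚ ℚ.- (B ℚ.- A) ℚ.* (b ℚ.* b) ℚ.- b ℚ.* b ℚ.* (A ℚ.+ ℚ.- (a ℚ.* a ℚ.* B))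
      factor = solve-∀ ℚ-ring
      vanish : ∀ b → 0ℚ ℚ.- b ℚ.* b ℚ.* 0ℚ ≡ 0ℚ
      vanish = solve-∀ ℚ-ring
    a²-1≡0⇒A≡B : a ℚ.* a ℚ.- 1ℚ ≡ 0ℚ → A ≡ B
    a²-1≡0⇒A≡B a²-1≡0 = ι-injective (begin
      ι A                  ≡⟨ A≡a²B ⟩
      a ℚ.* a ℚ.* ι B      ≡⟨ cong (ℚ._* ι B) (x∙y⁻¹≈ε⇒x≈y (a ℚ.* a) 1ℚ a²-1≡0) ⟩
      1ℚ ℚ.* ι B           ≡⟨ ℚ.*-identityˡ (ι B) ⟩
      ι B                  ∎)
    1+Bb²≡0⇒A≡B : 1ℚ ℚ.+ ι B ℚ.* (b ℚ.* b) ≡ 0ℚ → A ≡ B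
    1+Bb²≡0⇒A≡B 1+Bb²≡0 = trans A≡-1 (sym B≡-1)
      where
      B≡-1 : B ≡ ℤ.-1ℤ
      B≡-1 = SquareFree-scaledSquare≡-1 1ℚ b sfB b≢0 1+Bb²≡0
      A≡-1 : A ≡ ℤ.-1ℤ
      A≡-1 = SquareFree-scaledSquare≡-1 a 1ℚ sfA (λ ()) (begin
        a ℚ.* a ℚ.+ ι A ℚ.* (1ℚ ℚ.* 1ℚ)                 ≡⟨ cong (λ x → a ℚ.* a ℚ.+ x ℚ.* (1ℚ ℚ.* 1ℚ)) A≡a²B ⟩
        a ℚ.* a ℚ.+ a ℚ.* a ℚ.* ι B ℚ.* (1ℚ ℚ.* 1ℚ)     ≡⟨ cong (λ x → a ℚ.* a ℚ.+ a ℚ.* a ℚ.* ι x ℚ.* (1ℚ ℚ.* 1ℚ)) B≡-1 ⟩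
        a ℚ.* a ℚ.+ a ℚ.* a ℚ.* ℚ.- 1ℚ ℚ.* (1ℚ ℚ.* 1ℚ)  ≡⟨ cancel a ⟩
        0ℚ                                             ∎)
        where
        cancel : ∀ a → a ℚ.* a ℚ.+ a ℚ.* a ℚ.* ℚ.- 1ℚ ℚ.* (1ℚ ℚ.* 1ℚ) ≡ 0ℚ
        cancel = solve-∀ ℚ-ring

  κ-relativeNorm : κ *ᴷ conj√B κ ≡
    ⟨ m ℚ.* (1ℚ ℚ.+ ι A ℚ.* (b ℚ.* b)) , two ℚ.* (b ℚ.* (a ℚ.* a ℚ.+ ι B ℚ.* (b ℚ.* b))) , 0ℚ , 0ℚ ⟩
  κ-relativeNorm = byRing 5 0
    (λ { (A ∷ B ∷ C ∷ a ∷ b ∷ []) [] → let module E = Eᵂ A B C a b in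
         E.κ E.*ᴷ E.conj√B E.κ ,
         ⟨ E.m ⊗ₑ (Κ 1ℚ ⊕ₑ A ⊗ₑ (b ⊗ₑ b)) , E.two ⊗ₑ (b ⊗ₑ (a ⊗ₑ a ⊕ₑ B ⊗ₑ (b ⊗ₑ b))) , Κ 0ℚ , Κ 0ℚ ⟩ })
    (ι A ∷ ι B ∷ ι C ∷ a ∷ b ∷ []) [] refl

  -- κ conj√B κ = X + Y√A, and X² = AY² forces A = 1 if Y ≠ 0, and A = B = -1 if Y = 0.
  norm-κ≢0 : norm κ ≢ 0ℚ
  norm-κ≢0 norm≡0 = refute (Y ℚ.≟ 0ℚ)
    where
    open ≡-Reasoning
    X Y : ℚ
    X = m ℚ.* (1ℚ ℚ.+ ι A ℚ.* (b ℚ.* b))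
    Y = two ℚ.* (b ℚ.* (a ℚ.* a ℚ.+ ι B ℚ.* (b ℚ.* b)))
    X²≡AY² : X ℚ.* X ≡ ι A ℚ.* (Y ℚ.* Y)
    X²≡AY² = x∙y⁻¹≈ε⇒x≈y (X ℚ.* X) (ι A ℚ.* (Y ℚ.* Y))
               (trans (sym (cong (λ y → c₁ y ℚ.* c₁ y ℚ.+ ℚ.- (ι A ℚ.* (c√A y ℚ.* c√A y))) κ-relativeNorm)) norm≡0)
    A≡-1 : Y ≡ 0ℚ → A ≡ ℤ.-1ℤ
    A≡-1 Y≡0 = SquareFree-scaledSquare≡-1 1ℚ b sfA b≢0 (p≢0∧p*q≡0⇒q≡0 m≢0 X≡0)
      where
      X≡0 : X ≡ 0ℚ
      X≡0 = reduce (p*q≡0⇒p≡0∨q≡0 X X (begin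
        X ℚ.* X                ≡⟨ X²≡AY² ⟩
        ι A ℚ.* (Y ℚ.* Y)      ≡⟨ cong (λ y → ι A ℚ.* (y ℚ.* y)) Y≡0 ⟩
        ι A ℚ.* (0ℚ ℚ.* 0ℚ)    ≡⟨ ℚ.*-zeroʳ (ι A) ⟩
        0ℚ                     ∎))
    B≡-1 : Y ≡ 0ℚ → B ≡ ℤ.-1ℤ
    B≡-1 Y≡0 = SquareFree-scaledSquare≡-1 a b sfB b≢0 (p≢0∧p*q≡0⇒q≡0 b≢0 (p≢0∧p*q≡0⇒q≡0 {two} (λ ()) Y≡0))
    refute : Dec (Y ≡ 0ℚ) → ⊥
    refute (no  Y≢0) = A≢1 (SquareFree-scaledSquare≡1 X Y sfA Y≢0 (sym X²≡AY²))
    refute (yes Y≡0) = A≢B (trans (A≡-1 Y≡0) (sym (B≡-1 Y≡0)))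

  ιC≢0 : ι C ≢ 0ℚ
  ιC≢0 ιC≡0 = C≢0 (ι-injective ιC≡0)

  N≢0 : N ≢ 0ℚ
  N≢0 = p≢0∧q≢0⇒p*q≢0 {two} (λ ()) (p≢0∧q≢0⇒p*q≢0 ιC≢0 (p≢0∧q≢0⇒p*q≢0 b≢0 m≢0))

  2D≢0 : two ℚ.* D ≢ 0ℚ
  2D≢0 = p≢0∧q≢0⇒p*q≢0 {two} (λ ()) D≢0

  u a⁻¹ d⁻¹ n⁻¹ : ℚ
  u   = ℚ.1/_ N {{ℚ.≢-nonZero N≢0}}
  a⁻¹ = ℚ.1/_ a {{ℚ.≢-nonZero a≢0}}
  d⁻¹ = ℚ.1/_ (two ℚ.* D) {{ℚ.≢-nonZero 2D≢0}}
  n⁻¹ = ℚ.1/_ (norm κ) {{ℚ.≢-nonZero norm-κ≢0}}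

  u*N≡1 : u ℚ.* N ≡ 1ℚ
  u*N≡1 = ℚ.*-inverseˡ N {{ℚ.≢-nonZero N≢0}}

  a*a⁻¹≡1 : a ℚ.* a⁻¹ ≡ 1ℚ
  a*a⁻¹≡1 = ℚ.*-inverseʳ a {{ℚ.≢-nonZero a≢0}}

  2D*d⁻¹≡1 : two ℚ.* D ℚ.* d⁻¹ ≡ 1ℚ
  2D*d⁻¹≡1 = ℚ.*-inverseʳ (two ℚ.* D) {{ℚ.≢-nonZero 2D≢0}}

  n⁻¹*norm≡1 : n⁻¹ ℚ.* norm κ ≡ 1ℚ
  n⁻¹*norm≡1 = ℚ.*-inverseˡ (norm κ) {{ℚ.≢-nonZero norm-κ≢0}}

  W : K
  W = ι C ⋆ (κ *ᴷ κ)

  W≡c₀+Nv : W ≡ c₀ ⋆ 1ᴷ +ᴷ N ⋆ v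
  W≡c₀+Nv = begin
    ι C ⋆ (κ *ᴷ κ)                                         ≡⟨ byRing 5 0
      (λ { (A ∷ B ∷ C ∷ a ∷ b ∷ []) [] → let module E = Eᵂ A B C a b in
           C E.⋆ (E.κ E.*ᴷ E.κ) , ⟨ E.c₀ , E.N , a ⊗ₑ (E.two ⊗ₑ (C ⊗ₑ (b ⊗ₑ E.m′))) , Κ 0ℚ ⟩ })
      (ι A ∷ ι B ∷ ι C ∷ a ∷ b ∷ []) [] refl ⟩
    ⟨ c₀ , N , a ℚ.* (two ℚ.* (ι C ℚ.* (b ℚ.* m′))) , 0ℚ ⟩ ≡⟨ cong (λ x → ⟨ c₀ , N , a ℚ.* (two ℚ.* (ι C ℚ.* (b ℚ.* x))) , 0ℚ ⟩) m≡m′ ⟨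
    ⟨ c₀ , N , a ℚ.* N , 0ℚ ⟩                               ≡⟨ byRing 5 0
      (λ { (A ∷ B ∷ a ∷ c₀ ∷ N ∷ []) [] → let module E = Eⱽ A B a in
           ⟨ c₀ , N , a ⊗ₑ N , Κ 0ℚ ⟩ , c₀ E.⋆ E.1ᴷ E.+ᴷ N E.⋆ E.v })
      (ι A ∷ ι B ∷ a ∷ c₀ ∷ N ∷ []) [] refl ⟩
    c₀ ⋆ 1ᴷ +ᴷ N ⋆ v                                       ∎
    where open ≡-Reasoning

  v≡affine[W] : (ℚ.- (u ℚ.* c₀)) ⋆ 1ᴷ +ᴷ u ⋆ W ≡ v
  v≡affine[W] = begin
    (ℚ.- (u ℚ.* c₀)) ⋆ 1ᴷ +ᴷ u ⋆ W                        ≡⟨ cong (λ w → (ℚ.- (u ℚ.* c₀)) ⋆ 1ᴷ +ᴷ u ⋆ w) W≡c₀+Nv ⟩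
    (ℚ.- (u ℚ.* c₀)) ⋆ 1ᴷ +ᴷ u ⋆ (c₀ ⋆ 1ᴷ +ᴷ N ⋆ v)      ≡⟨ affine-inverse u c₀ N v ⟩
    (u ℚ.* N) ⋆ v                                         ≡⟨ cong (_⋆ v) u*N≡1 ⟩
    1ℚ ⋆ v                                                ≡⟨ ⋆-identityˡ v ⟩
    v                                                     ∎
    where open ≡-Reasoning

  -- 1, v, v², v³ is a basis of K because a ≠ 0 and D = A - a²B ≠ 0.
  v-surjective : ∀ z → horner (toList (vCoordinates ½ a⁻¹ d⁻¹ z)) v ≡ z
  v-surjective z = begin
    horner (toList (vCoordinates ½ a⁻¹ d⁻¹ z)) v                       ≡⟨ byRing 5 1
      (λ { (A ∷ B ∷ a ∷ a⁻¹ ∷ d⁻¹ ∷ []) (z ∷ []) → let module E = Eⱽ A B a in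
           E.horner (toList (E.vCoordinates (Κ ½) a⁻¹ d⁻¹ z)) E.v ,
           ⟨ c₁ z , c√A z , a ⊗ₑ c√A z ⊕ₑ E.two ⊗ₑ E.D ⊗ₑ d⁻¹ ⊗ₑ (a ⊗ₑ a⁻¹ ⊗ₑ c√B z ⊕ₑ ⊝ (a ⊗ₑ c√A z)) ,
             a ⊗ₑ a⁻¹ ⊗ₑ c√AB z ⟩ })
      (ι A ∷ ι B ∷ a ∷ a⁻¹ ∷ d⁻¹ ∷ []) (z ∷ []) refl ⟩
    ⟨ c₁ z , c√A z , a ℚ.* c√A z ℚ.+ two ℚ.* D ℚ.* d⁻¹ ℚ.* (a ℚ.* a⁻¹ ℚ.* c√B z ℚ.+ ℚ.- (a ℚ.* c√A z)) ,
      a ℚ.* a⁻¹ ℚ.* c√AB z ⟩                                             ≡⟨ cong₂ (λ p q → ⟨ c₁ z , c√A z ,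
                                                                            a ℚ.* c√A z ℚ.+ q ℚ.* (p ℚ.* c√B z ℚ.+ ℚ.- (a ℚ.* c√A z)) ,
                                                                            p ℚ.* c√AB z ⟩)
                                                                            a*a⁻¹≡1 2D*d⁻¹≡1 ⟩
    ⟨ c₁ z , c√A z , a ℚ.* c√A z ℚ.+ 1ℚ ℚ.* (1ℚ ℚ.* c√B z ℚ.+ ℚ.- (a ℚ.* c√A z)) , 1ℚ ℚ.* c√AB z ⟩ ≡⟨ byRing 1 1
      (λ { (a ∷ []) (z ∷ []) →
           ⟨ c₁ z , c√A z , a ⊗ₑ c√A z ⊕ₑ Κ 1ℚ ⊗ₑ (Κ 1ℚ ⊗ₑ c√B z ⊕ₑ ⊝ (a ⊗ₑ c√A z)) , Κ 1ℚ ⊗ₑ c√AB z ⟩ , z })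
      (a ∷ []) (z ∷ []) refl ⟩
    z                                                                  ∎
    where open ≡-Reasoning

  Wcoordinates : K → Vec ℚ 4
  Wcoordinates z = shift (ℚ.- (u ℚ.* c₀)) u (vCoordinates ½ a⁻¹ d⁻¹ z)

  W-surjective : ∀ z → horner (toList (Wcoordinates z)) W ≡ z
  W-surjective z = begin
    horner (toList (Wcoordinates z)) W                      ≡⟨ horner-shift (ℚ.- (u ℚ.* c₀)) u q W ⟩
    horner (toList q) ((ℚ.- (u ℚ.* c₀)) ⋆ 1ᴷ +ᴷ u ⋆ W)      ≡⟨ cong (horner (toList q)) v≡affine[W] ⟩
    horner (toList q) v                                     ≡⟨ v-surjective z ⟩
    z                                                       ∎
    where
    open ≡-Reasoning
    q : Vec ℚ 4
    q = vCoordinates ½ a⁻¹ d⁻¹ z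

  κ⁻¹* : K → K
  κ⁻¹* z = n⁻¹ ⋆ (adjugate κ *ᴷ z)

  κ*κ⁻¹* : ∀ z → κ *ᴷ κ⁻¹* z ≡ z
  κ*κ⁻¹* z = begin
    κ *ᴷ n⁻¹ ⋆ (adjugate κ *ᴷ z)  ≡⟨ *-adjugate n⁻¹ κ z ⟩
    (n⁻¹ ℚ.* norm κ) ⋆ z          ≡⟨ cong (_⋆ z) n⁻¹*norm≡1 ⟩
    1ℚ ⋆ z                                ≡⟨ ⋆-identityˡ z ⟩
    z                                     ∎
    where open ≡-Reasoning

  β : L
  β = 0ᴷ ⊹ κ

  evalPoly-interleave : ∀ (p q : Vec ℚ 4) → evalPoly (interleave p q) β ≈ (horner (toList p) W ⊹ κ *ᴷ horner (toList q) W)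
  evalPoly-interleave p q = ≈-from-lo-hi _ (horner (toList p) W ⊹ κ *ᴷ horner (toList q) W) lo≡ hi≡
    where
    lo≡ : lo (evalPoly (interleave p q) β) ≡ horner (toList p) W
    lo≡ = trans (proj₁ (evalPoly-√C· κ (interleave p q)))
                (cong (λ cs → horner cs W) (evens-interleave p q))
    hi≡ : hi (evalPoly (interleave p q) β) ≡ κ *ᴷ horner (toList q) W
    hi≡ = trans (proj₂ (evalPoly-√C· κ (interleave p q)))
                (cong (λ cs → κ *ᴷ horner cs W) {odds (interleave p q)} {toList q} (odds-interleave p q))

  β-primitive : Primitive β
  β-primitive z = interleave p q , λ t → trans (evalPoly-interleave p q t) (≈-from-lo-hi (P ⊹ Q) z lo≡ hi≡ t)
    where
    p q : Vec ℚ 4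
    p = Wcoordinates (lo z)
    q = Wcoordinates (κ⁻¹* (hi z))
    P Q : K
    P = horner (toList p) W
    Q = κ *ᴷ horner (toList q) W
    lo≡ : P ≡ lo z
    lo≡ = W-surjective (lo z)
    hi≡ : Q ≡ hi z
    hi≡ = trans (cong (κ *ᴷ_) {horner (toList q) W} {κ⁻¹* (hi z)} (W-surjective (κ⁻¹* (hi z)))) (κ*κ⁻¹* (hi z))

  β-degree : DegAlpha β (√A +L (a ·L √B)) 2
  β-degree = s≤s (s≤s z≤n) , f , u≢0 , ≈-from-lo-hi _ _ lo≡ hi≡
    where
    open ≡-Reasoning
    f : Vec ℚ 3
    f = ℚ.- (u ℚ.* c₀) ∷ 0ℚ ∷ u ∷ []
    u≢0 : u ≢ 0ℚ
    u≢0 u≡0 = ℚ.1≢0 (begin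
      1ℚ       ≡⟨ u*N≡1 ⟨
      u ℚ.* N  ≡⟨ cong (ℚ._* N) u≡0 ⟩
      0ℚ ℚ.* N ≡⟨ ℚ.*-zeroˡ N ⟩
      0ℚ       ∎)
    lo≡ : lo (evalPoly f β) ≡ lo (√A +L (a ·L √B))
    lo≡ = begin
      lo (evalPoly f β)                      ≡⟨ proj₁ (evalPoly-√C· κ f) ⟩
      horner (ℚ.- (u ℚ.* c₀) ∷ u ∷ []) W     ≡⟨ horner-linear (ℚ.- (u ℚ.* c₀)) u W ⟩
      (ℚ.- (u ℚ.* c₀)) ⋆ 1ᴷ +ᴷ u ⋆ W         ≡⟨ v≡affine[W] ⟩
      v                                      ≡⟨ lo-√A+a√B a ⟨
      lo (√A +L (a ·L √B))                   ∎
    hi≡ : hi (evalPoly f β) ≡ hi (√A +L (a ·L √B))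
    hi≡ = begin
      hi (evalPoly f β)               ≡⟨ proj₂ (evalPoly-√C· κ f) ⟩
      κ *ᴷ horner (0ℚ ∷ []) W         ≡⟨ byRing 2 2
        (λ { (A ∷ B ∷ []) (x ∷ y ∷ []) → let module E = Eᴷ A B in x E.*ᴷ E.horner (Κ 0ℚ ∷ []) y , E.0ᴷ })
        (ι A ∷ ι B ∷ []) (κ ∷ W ∷ []) refl ⟩
      0ᴷ                              ≡⟨ hi-√A+a√B a ⟨
      hi (√A +L (a ·L √B))            ∎

-- The lower bound

module LowerBound (A B C : ℤ) (a : ℚ) where
  open Triquadratic A B C
  open TriquadraticField A B C

  2≤deg : ∀ α d → Primitive α → DegAlpha α (√A +L (a ·L √B)) d → 2 ℕ.≤ d
  2≤deg α 0 _ (_ , c ∷ [] , _ , f[α]≈v) = ⊥-elim (ℚ.1≢0 (begin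
    1ℚ                                 ≡⟨ cong c√A (trans (lo-cong f[α]≈v) (lo-√A+a√B a)) ⟨
    c√A (lo (evalPoly (c ∷ []) α))     ≡⟨ cong c√A (lo-evalPoly-constant α c) ⟩
    c ℚ.* 0ℚ                           ≡⟨ ℚ.*-zeroʳ c ⟩
    0ℚ                                 ∎))
    where open ≡-Reasoning
  2≤deg α 1 α-primitive (_ , c ∷ d ∷ [] , d≢0 , f[α]≈v) =
    ⊥-elim (hi≡0⇒¬primitive α (⋆-cancel d≢0 (begin
      d ⋆ hi α                            ≡⟨ hi-evalPoly-linear α c d ⟨
      hi (evalPoly (c ∷ d ∷ []) α)        ≡⟨ hi-cong f[α]≈v ⟩
      hi (√A +L (a ·L √B))                ≡⟨ hi-√A+a√B a ⟩
      0ᴷ                                  ∎)) α-primitive)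
    where open ≡-Reasoning
  2≤deg α (ℕ.suc (ℕ.suc d)) _ _ = s≤s (s≤s z≤n)

theorem5p8 : (A B C : ℤ) →
    A ≢ ℤ.0ℤ → B ≢ ℤ.0ℤ → C ≢ ℤ.0ℤ → (A ℤ.* B ℤ.* C) ≢ ℤ.0ℤ →
    SquareFree A → SquareFree B → SquareFree C → SquareFree (A ℤ.* B ℤ.* C) →
    A ≢ B → A ≢ C → B ≢ C → A ≢ A ℤ.* B ℤ.* C → B ≢ A ℤ.* B ℤ.* C → C ≢ A ℤ.* B ℤ.* C →
    A ≢ ℤ.1ℤ → B ≢ ℤ.1ℤ → C ≢ ℤ.1ℤ →
    (a b : ℚ) → a ≢ 0ℚ → b ≢ 0ℚ →
    a ℚ.* a ℚ.- 1ℚ ≡ (ι B ℚ.- ι A) ℚ.* (b ℚ.* b) →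
    ι B ≢ a →
    Triquadratic.MinDeg A B C (Triquadratic._+L_ A B C (Triquadratic.√A A B C)
                                 (Triquadratic._·L_ A B C a (Triquadratic.√B A B C))) 2
theorem5p8 A B C _ _ C≢0 _ sfA sfB _ _ A≢B _ _ _ _ _ A≢1 B≢1 _ a b a≢0 b≢0 pell _ =
  (β , β-primitive , β-degree) , LowerBound.2≤deg A B C a
  where open UpperBound A B C a b sfA sfB A≢B A≢1 B≢1 a≢0 b≢0 C≢0 pell
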